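{- Let $n$ be a positive integer, $S=\{1,2,\dots,n\}$, and let $f:S\to\mathbb{Z}$ be monotone increasing with $f(1)=1$. If for all $i,j\in S$, $|j-i|\equiv 1\pmod 3$ implies $|f(j)-f(i)|\equiv 1\pmod 3$, then $f(i)\equiv i\pmod 3$ for all $i\in S$. -}

module Defs where

open import Data.Nat using (ℕ)
open import Data.Integer using (ℤ; +_; _-_; ∣_∣)
open import Data.Integer.Divisibility using (_∣_)

infix 4 _≡₃_
_≡₃_ : ℤ → ℤ → Set
a ≡₃ b = (+ 3) ∣ (a - b)

absDiff : ℕ → ℕ → ℤ
absDiff i j = + ∣ (+ j) - (+ i) ∣

-- Only neighbouring arguments are needed: since f is monotone, f (i + 1) - f i is
-- non-negative, so it equals its absolute value and is ≡ 1 (mod 3) by hypothesis.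
-- Hence f (i + 1) ≡ f i + 1, and induction from f 1 = 1 gives f i ≡ i.
module Submission where

open import Defs
open import Data.Nat using (ℕ; _≤_; zero; suc; s≤s; z≤n)
open import Data.Nat.Properties using (≤-trans; n≤1+n; +-comm)
import Data.Nat.Divisibility as ℕ
open import Data.Integer using (ℤ; +_; _-_; ∣_∣; _+_; _⊖_) renaming (_≤_ to _≤ℤ_)
open import Data.Integer.Properties
  using (+-inverseʳ; [+m]-[+n]≡m⊖n; [1+m]⊖[1+n]≡m⊖n; 0≤i⇒+∣i∣≡i; i≤j⇒0≤j-i)
import Data.Integer.Divisibility.Signed as Signed
open import Data.Integer.Tactic.RingSolver using (solve-∀)
open import Relation.Binary.PropositionalEquality using (_≡_; refl; sym; trans; cong; subst)

≡₃-refl : ∀ a → a ≡₃ a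
≡₃-refl a rewrite +-inverseʳ a = 3 ℕ.∣0

≡₃-respˡ : ∀ {a b c} → a ≡ b → a ≡₃ c → b ≡₃ c
≡₃-respˡ {c = c} = subst (_≡₃ c)

telescope : ∀ a b c d → ((b - a) - d) + (a - c) ≡ b - (c + d)
telescope = solve-∀

≡₃-step : ∀ a b {c d} → a ≡₃ c → b - a ≡₃ d → b ≡₃ c + d
≡₃-step a b {c} {d} a≡c b-a≡d =
  Signed.∣⇒∣ᵤ (subst (Signed._∣_ (+ 3)) (telescope a b c d)
    (Signed.∣m∣n⇒∣m+n (Signed.∣ᵤ⇒∣ {i = (b - a) - d} b-a≡d)
                      (Signed.∣ᵤ⇒∣ {i = a - c} a≡c)))

[1+m]⊖m≡1 : ∀ m → suc m ⊖ m ≡ + 1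
[1+m]⊖m≡1 zero    = refl
[1+m]⊖m≡1 (suc m) = trans ([1+m]⊖[1+n]≡m⊖n (suc m) m) ([1+m]⊖m≡1 m)

absDiff-suc : ∀ i → absDiff i (suc i) ≡ + 1
absDiff-suc i = cong (λ d → + ∣ d ∣) (trans ([+m]-[+n]≡m⊖n (suc i) i) ([1+m]⊖m≡1 i))

∣j-i∣≡j-i : ∀ {i j} → i ≤ℤ j → + ∣ j - i ∣ ≡ j - i
∣j-i∣≡j-i i≤j = 0≤i⇒+∣i∣≡i (i≤j⇒0≤j-i i≤j)

+m+1≡+[1+m] : ∀ m → + m + + 1 ≡ + suc m
+m+1≡+[1+m] m = cong +_ (+-comm m 1)

lemma4p7 : (n : ℕ) → 1 ≤ n → (f : ℕ → ℤ)
         → (∀ i j → 1 ≤ i → i ≤ j → j ≤ n → f i ≤ℤ f j)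
         → f 1 ≡ + 1
         → (∀ i j → 1 ≤ i → i ≤ n → 1 ≤ j → j ≤ n
              → absDiff i j ≡₃ + 1 → (+ ∣ f j - f i ∣) ≡₃ + 1)
         → ∀ i → 1 ≤ i → i ≤ n → f i ≡₃ (+ i)
lemma4p7 n _ f mono f1≡1 steps≡1 = go
  where
  go : ∀ i → 1 ≤ i → i ≤ n → f i ≡₃ (+ i)
  go 1 _ _ = ≡₃-respˡ (sym f1≡1) (≡₃-refl (+ 1))
  go (suc i@(suc _)) _ 1+i≤n =
    subst (f (suc i) ≡₃_) (+m+1≡+[1+m] i)
      (≡₃-step (f i) (f (suc i)) (go i (s≤s z≤n) i≤n) step≡1)
    where
    i≤n : i ≤ n
    i≤n = ≤-trans (n≤1+n i) 1+i≤n
    step≡1 : f (suc i) - f i ≡₃ + 1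
    step≡1 = ≡₃-respˡ (∣j-i∣≡j-i (mono i (suc i) (s≤s z≤n) (n≤1+n i) 1+i≤n))
      (steps≡1 i (suc i) (s≤s z≤n) i≤n (s≤s z≤n) 1+i≤n
        (≡₃-respˡ {c = + 1} (sym (absDiff-suc i)) (≡₃-refl (+ 1))))
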